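{- Let $\mathcal{A}$ be a finite alphabet with at least two letters and let $w\in\mathcal{A}^+$. Let $\mathcal{C}$ be the autocorrelation set of $w$, $\mathcal{C}_\circ=\mathcal{C}\setminus\{\epsilon\}$, $\mathcal{K}=\mathcal{C}_\circ\setminus\mathcal{C}_\circ\mathcal{A}^+$, and let $\mathcal{M}$ be the minimal language of $w$. Then $\mathcal{K}\subset\mathcal{M}$ and there exists a non-empty language $\mathcal{L}\subseteq\mathcal{A}^\star$ such that $\mathcal{M}\setminus\mathcal{K}=\mathcal{L}\,w$.
   Context: $\epsilon$ is the empty word, $\mathcal{A}^+=\mathcal{A}^\star\setminus\{\epsilon\}$. The autocorrelation set of $w$ is $\mathcal{C}=\{e\in\mathcal{A}^\star : |e|<|w|,\ we\in\mathcal{A}^\star w\}$ (it contains $\epsilon$). The minimal language of $w$ is $\mathcal{M}=\{m\in\mathcal{A}^+ : wm\in\mathcal{A}^\star w \text{ and } w \text{ occurs in } wm \text{ exactly twice, namely as a prefix and as a suffix}\}$, i.e. the set of nonempty words $m$ such that $wm$ ends with $w$ and has no occurrence of $w$ other than at its beginning and at its end. For a language $\mathcal{L}$, $\mathcal{L}w=\{xw: x\in\mathcal{L}\}$. -}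

module Defs where

open import Data.Nat using (ℕ; _<_)
open import Data.List using (List; []; _++_; length)
open import Data.Product using (Σ; ∃; _×_)
open import Data.Sum using (_⊎_)
open import Relation.Nullary using (¬_)
open import Relation.Binary.PropositionalEquality using (_≡_; _≢_)

Language : Set → Set₁
Language A = List A → Set

module _ {A : Set} where

  EndsWith : List A → List A → Set
  EndsWith w u = ∃ λ x → u ≡ x ++ w

  Autocorr : List A → Language A
  Autocorr w e = length e < length w × EndsWith w (w ++ e)

  Autocorr∘ : List A → Language A
  Autocorr∘ w e = Autocorr w e × e ≢ []

  KSet : List A → Language A
  KSet w e = Autocorr∘ w e
           × ¬ (Σ (List A) λ c → Σ (List A) λ a → Autocorr∘ w c × a ≢ [] × e ≡ c ++ a)

  Minimal : List A → Language A
  Minimal w m = m ≢ []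
              × EndsWith w (w ++ m)
              × (∀ p s → w ++ m ≡ p ++ w ++ s → p ≡ [] ⊎ s ≡ [])

-- If w occurs in wm at an offset p ≠ ε shorter than w, the overlap yields a
-- nonempty autocorrelation word c with m = c s; so a word of K has no inner
-- occurrence of w, and a minimal word shorter than w must lie in C∘ but not
-- in C∘A⁺, i.e. in K. Every other minimal word therefore ends with w. For a
-- witness of L, pad w with |w| copies of a letter b different from the first
-- letter a of w: an inner occurrence of w in w bⁿ w cannot start inside bⁿ,
-- and one overlapping the first w would give a nonempty autocorrelation word
-- c free of a, impossible since w c = p w has as many a's on both sides while
-- p ≠ ε starts with a.
module Submission where

open import Defs
open import Data.Nat using (ℕ; suc; _≤_; _<_; s≤s)
open import Data.Nat.Properties using (≤-trans; ≤-reflexive; ≤⇒≯)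
open import Data.Fin using (Fin; zero; punchIn)
open import Data.Fin.Properties using (_≟_; punchInᵢ≢i)
open import Data.List using (List; []; _∷_; _++_; length; replicate; filter)
open import Data.List.Properties
  using ( ∷-injective; ∷-injectiveˡ; ∷-injectiveʳ; ++-assoc; ++-identityʳ
        ; ++-identityʳ-unique; ++-identityˡ-unique; ++-cancelˡ; ++-conicalʳ
        ; length-++-≤ˡ; length-++-≤ʳ; length-replicate
        ; filter-++; filter-none; filter-accept )
open import Data.List.Relation.Unary.All using (All; _∷_)
open import Data.List.Relation.Unary.All.Properties using (++⁻ˡ; replicate⁺)
open import Data.Product using (Σ; ∃; ∃₂; _×_; _,_; proj₁; proj₂)
open import Data.Sum using (_⊎_; inj₁; inj₂; [_,_]′)
open import Data.Empty using (⊥-elim)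
open import Relation.Nullary using (¬_; contradiction)
open import Relation.Binary.Definitions using (DecidableEquality)
open import Relation.Binary.PropositionalEquality
  using (_≡_; _≢_; refl; sym; trans; cong; cong₂; subst; module ≡-Reasoning)
open import Function.Bundles using (_⇔_; mk⇔)

module _ {A : Set} where

  open ≡-Reasoning

  ++-equidivisible : ∀ (xs ys us vs : List A) → xs ++ ys ≡ us ++ vs →
    (∃ λ r → r ≢ [] × xs ≡ us ++ r × vs ≡ r ++ ys) ⊎ (∃ λ r → us ≡ xs ++ r × ys ≡ r ++ vs)
  ++-equidivisible []       ys us       vs eq = inj₂ (us , refl , eq)
  ++-equidivisible (x ∷ xs) ys []       vs eq = inj₁ (x ∷ xs , (λ ()) , refl , sym eq)
  ++-equidivisible (x ∷ xs) ys (u ∷ us) vs eq with ∷-injective eq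
  ... | refl , eq′ with ++-equidivisible xs ys us vs eq′
  ...   | inj₁ (r , r≢[] , xs≡us++r , vs≡r++ys) = inj₁ (r , r≢[] , cong (x ∷_) xs≡us++r , vs≡r++ys)
  ...   | inj₂ (r , us≡xs++r , ys≡r++vs)       = inj₂ (r , cong (x ∷_) us≡xs++r , ys≡r++vs)

  suffix-length-< : ∀ {xs} (ys zs : List A) → xs ≡ ys ++ zs → ys ≢ [] → length zs < length xs
  suffix-length-< []       _  _    ys≢[] = contradiction refl ys≢[]
  suffix-length-< (_ ∷ ys) zs refl _     = s≤s (length-++-≤ʳ zs {ys})

  infix-length-≤ : ∀ {xs} (ys zs : List A) {us} → xs ≡ ys ++ zs ++ us → length zs ≤ length xs
  infix-length-≤ ys zs {us} refl = ≤-trans (length-++-≤ˡ zs) (length-++-≤ʳ (zs ++ us) {ys})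

  ++-identity-unique : ∀ xs {ys zs : List A} → xs ≡ ys ++ xs ++ zs → ys ≡ [] × zs ≡ []
  ++-identity-unique xs {[]}     eq = refl , ++-identityʳ-unique xs eq
  ++-identity-unique xs {y ∷ ys} {zs} eq =
    ⊥-elim (≤⇒≯ (length-++-≤ˡ xs) (suffix-length-< (y ∷ ys) (xs ++ zs) eq (λ ())))

  border-≢[] : ∀ {w c p : List A} → w ++ c ≡ p ++ w → p ≢ [] → c ≢ []
  border-≢[] {w} eq p≢[] refl = p≢[] (++-identityˡ-unique _ (trans (sym (++-identityʳ w)) eq))

  occurrence-in-++ : ∀ w m p s → w ++ m ≡ p ++ w ++ s → p ≢ [] →
    (∃ λ c → Autocorr∘ w c × m ≡ c ++ s) ⊎ (∃ λ q → m ≡ q ++ w ++ s)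
  occurrence-in-++ w m p s eq p≢[] with ++-equidivisible w m p (w ++ s) eq
  ... | inj₂ (q , _ , m≡q++w++s) = inj₂ (q , m≡q++w++s)
  ... | inj₁ (r , r≢[] , w≡p++r , w++s≡r++m) with ++-equidivisible r m w s (sym w++s≡r++m)
  ...   | inj₁ (t , _ , r≡w++t , _) =
          contradiction (proj₁ (++-identity-unique w (trans w≡p++r (cong (p ++_) r≡w++t)))) p≢[]
  ...   | inj₂ (c , w≡r++c , m≡c++s) =
          inj₁ (c , ((suffix-length-< r c w≡r++c r≢[] , p , w++c≡p++w) , border-≢[] w++c≡p++w p≢[]) , m≡c++s)
    where
    w++c≡p++w : w ++ c ≡ p ++ w
    w++c≡p++w = begin
      w ++ c        ≡⟨ cong (_++ c) w≡p++r ⟩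
      (p ++ r) ++ c ≡⟨ ++-assoc p r c ⟩
      p ++ r ++ c   ≡⟨ cong (p ++_) w≡r++c ⟨
      p ++ w        ∎

  EndsWith-++⇒EndsWith⊎shorter : ∀ w m → EndsWith w (w ++ m) → EndsWith w m ⊎ length m < length w
  EndsWith-++⇒EndsWith⊎shorter w m (y , eq) with ++-equidivisible w m y w eq
  ... | inj₁ (r , r≢[] , _ , w≡r++m) = inj₂ (suffix-length-< r m w≡r++m r≢[])
  ... | inj₂ (r , _ , m≡r++w)         = inj₁ (r , m≡r++w)

  InnerOccurrence : List A → List A → Set
  InnerOccurrence w u = ∃₂ λ p s → p ≢ [] × s ≢ [] × u ≡ p ++ w ++ s

  ¬InnerOccurrence⇒at-ends : ∀ {w u} → ¬ InnerOccurrence w u →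
                             ∀ p s → u ≡ p ++ w ++ s → p ≡ [] ⊎ s ≡ []
  ¬InnerOccurrence⇒at-ends _      []      _       _  = inj₁ refl
  ¬InnerOccurrence⇒at-ends _      (_ ∷ _) []      _  = inj₂ refl
  ¬InnerOccurrence⇒at-ends ¬inner p@(_ ∷ _) s@(_ ∷ _) eq = ⊥-elim (¬inner (p , s , (λ ()) , (λ ()) , eq))

  at-ends⇒¬InnerOccurrence : ∀ {w u} → (∀ p s → u ≡ p ++ w ++ s → p ≡ [] ⊎ s ≡ []) →
                             ¬ InnerOccurrence w u
  at-ends⇒¬InnerOccurrence at-ends (p , s , p≢[] , s≢[] , eq) = [ p≢[] , s≢[] ]′ (at-ends p s eq)

  Autocorr∘-++⇒InnerOccurrence : ∀ {w c a} → Autocorr∘ w c → a ≢ [] → InnerOccurrence w (w ++ c ++ a)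
  Autocorr∘-++⇒InnerOccurrence {w} {c} {a} ((_ , z , w++c≡z++w) , c≢[]) a≢[] = z , a , z≢[] , a≢[] , eq
    where
    z≢[] : z ≢ []
    z≢[] refl = c≢[] (++-identityʳ-unique w (sym w++c≡z++w))
    eq : w ++ c ++ a ≡ z ++ w ++ a
    eq = begin
      w ++ c ++ a   ≡⟨ ++-assoc w c a ⟨
      (w ++ c) ++ a ≡⟨ cong (_++ a) w++c≡z++w ⟩
      (z ++ w) ++ a ≡⟨ ++-assoc z w a ⟩
      z ++ w ++ a   ∎

  KSet⊆Minimal : ∀ w e → KSet w e → Minimal w e
  KSet⊆Minimal w e (((e<w , ends) , e≢[]) , e∉C∘A⁺) = e≢[] , ends , ¬InnerOccurrence⇒at-ends no-inner
    where
    no-inner : ¬ InnerOccurrence w (w ++ e)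
    no-inner (p , s , p≢[] , s≢[] , eq) with occurrence-in-++ w e p s eq p≢[]
    ... | inj₁ (c , c∈C∘ , e≡c++s) = e∉C∘A⁺ (c , s , c∈C∘ , s≢[] , e≡c++s)
    ... | inj₂ (q , e≡q++w++s)     = ≤⇒≯ (infix-length-≤ q w e≡q++w++s) e<w

  Minimal∖KSet⇒EndsWith : ∀ w m → Minimal w m → ¬ KSet w m → EndsWith w m
  Minimal∖KSet⇒EndsWith w m (m≢[] , ends , at-ends) m∉K with EndsWith-++⇒EndsWith⊎shorter w m ends
  ... | inj₁ m∈A*w = m∈A*w
  ... | inj₂ m<w   = contradiction (((m<w , ends) , m≢[]) , m∉C∘A⁺) m∉K
    where
    m∉C∘A⁺ : ¬ (Σ (List A) λ c → Σ (List A) λ a → Autocorr∘ w c × a ≢ [] × m ≡ c ++ a)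
    m∉C∘A⁺ (c , a , c∈C∘ , a≢[] , m≡c++a) =
      at-ends⇒¬InnerOccurrence at-ends
        (subst (λ u → InnerOccurrence w (w ++ u)) (sym m≡c++a) (Autocorr∘-++⇒InnerOccurrence c∈C∘ a≢[]))

  letter-after-free-prefix : ∀ {a : A} {x v q u} → All (_≢ a) x → x ++ v ≡ q ++ a ∷ u → ∃ λ t → q ≡ x ++ t
  letter-after-free-prefix {x = []} {q = q} _ _ = q , refl
  letter-after-free-prefix {x = _ ∷ _} {q = []} (x₀≢a ∷ _) eq = contradiction (∷-injectiveˡ eq) x₀≢a
  letter-after-free-prefix {x = _ ∷ _} {q = _ ∷ _} (_ ∷ x∌a) eq =
    let t , q≡x++t = letter-after-free-prefix x∌a (∷-injectiveʳ eq)
    in  t , cong₂ _∷_ (sym (∷-injectiveˡ eq)) q≡x++t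

  module _ (_≟ᴬ_ : DecidableEquality A) where

    Autocorr∘-contains-head : ∀ {a w c} → Autocorr∘ (a ∷ w) c → ¬ All (_≢ a) c
    Autocorr∘-contains-head {a} {w} ((_ , [] , eq) , c≢[]) _ = c≢[] (++-identityʳ-unique (a ∷ w) (sym eq))
    Autocorr∘-contains-head {a} {w} {c} ((_ , p₀ ∷ p , eq) , _) c∌a with ∷-injective eq
    ... | refl , _ = contradiction (trans (sym (filter-accept (_≟ᴬ a) refl)) (++-identityˡ-unique _ balance)) λ ()
      where
      only-a : List A → List A
      only-a = filter (_≟ᴬ a)
      balance : only-a (a ∷ w) ≡ only-a (a ∷ p) ++ only-a (a ∷ w)
      balance = begin
        only-a (a ∷ w)                   ≡⟨ ++-identityʳ (only-a (a ∷ w)) ⟨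
        only-a (a ∷ w) ++ []             ≡⟨ cong (only-a (a ∷ w) ++_) (filter-none (_≟ᴬ a) c∌a) ⟨
        only-a (a ∷ w) ++ only-a c       ≡⟨ filter-++ (_≟ᴬ a) (a ∷ w) c ⟨
        only-a ((a ∷ w) ++ c)            ≡⟨ cong only-a eq ⟩
        only-a ((a ∷ p) ++ a ∷ w)        ≡⟨ filter-++ (_≟ᴬ a) (a ∷ p) (a ∷ w) ⟩
        only-a (a ∷ p) ++ only-a (a ∷ w) ∎

    Minimal-free-padding : ∀ {a w x} → All (_≢ a) x → length (a ∷ w) ≤ length x →
                           Minimal (a ∷ w) (x ++ a ∷ w)
    Minimal-free-padding {a} {w} {x} x∌a w≤x =
      (λ eq → contradiction (++-conicalʳ x (a ∷ w) eq) λ ()) ,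
      ((a ∷ w) ++ x , sym (++-assoc (a ∷ w) x (a ∷ w))) ,
      ¬InnerOccurrence⇒at-ends no-inner
      where
      no-inner : ¬ InnerOccurrence (a ∷ w) ((a ∷ w) ++ x ++ a ∷ w)
      no-inner (p , s , p≢[] , s≢[] , eq) with occurrence-in-++ (a ∷ w) (x ++ a ∷ w) p s eq p≢[]
      ... | inj₁ (c , c∈C∘@((c<w , _) , _) , x++w≡c++s) with ++-equidivisible x (a ∷ w) c s x++w≡c++s
      ...   | inj₁ (r , _ , x≡c++r , _) = Autocorr∘-contains-head c∈C∘ (++⁻ˡ c (subst (All _) x≡c++r x∌a))
      ...   | inj₂ (r , c≡x++r , _)     = ≤⇒≯ (≤-trans w≤x (infix-length-≤ [] x c≡x++r)) c<w
      no-inner (p , s , p≢[] , s≢[] , eq) | inj₂ (q , x++w≡q++w++s)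
        with letter-after-free-prefix x∌a x++w≡q++w++s
      ... | t , refl = s≢[] (proj₂ (++-identity-unique (a ∷ w)
                         (++-cancelˡ x _ _ (trans x++w≡q++w++s (++-assoc x t _)))))

lemma2 : (k : ℕ) → (w : List (Fin (suc (suc k)))) → w ≢ [] →
    (∀ e → KSet w e → Minimal w e)
    × Σ (Language (Fin (suc (suc k)))) (λ L →
        (∃ λ x → L x)
        × (∀ m → (Minimal w m × ¬ KSet w m) ⇔ (∃ λ x → L x × m ≡ x ++ w)))
lemma2 k []        w≢[] = contradiction refl w≢[]
lemma2 k w@(a ∷ _) _    = KSet⊆Minimal w , L , (x , x∈L) , λ m → mk⇔ (to m) (from m)
  where
  L : Language (Fin (suc (suc k)))
  L x = Minimal w (x ++ w) × ¬ KSet w (x ++ w)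
  x : List (Fin (suc (suc k)))
  x = replicate (length w) (punchIn a zero)
  x∈L : L x
  x∈L = Minimal-free-padding _≟_ (replicate⁺ (length w) (punchInᵢ≢i a zero))
                                 (≤-reflexive (sym (length-replicate (length w))))
      , λ (((x++w<w , _) , _) , _) → ≤⇒≯ (length-++-≤ʳ w {x}) x++w<w
  to : ∀ m → Minimal w m × ¬ KSet w m → ∃ λ y → L y × m ≡ y ++ w
  to m (m∈M , m∉K) with Minimal∖KSet⇒EndsWith w m m∈M m∉K
  ... | y , refl = y , (m∈M , m∉K) , refl
  from : ∀ m → (∃ λ y → L y × m ≡ y ++ w) → Minimal w m × ¬ KSet w m
  from m (y , y∈L , refl) = y∈L
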